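{- Let $G$ be a finite simple graph with a vertex cut $\{x,y\}$ of size $2$, let $H$ be a component of $G-\{x,y\}$, and let $G'$ be the switching of $G$ at $\{x,y\}$ with respect to $H$. Then $e(G')=e(G)$, and $G'$ contains a cycle of length divisible by $4$ if and only if $G$ does.
   Context: The switching of $G$ at $\{x,y\}$ (with respect to the component $H$ of $G-\{x,y\}$) is the graph obtained from $G$ by first removing all edges between $\{x,y\}$ and $V(H)$, and then adding the edges $\{xz: yz\in E(G), z\in V(H)\}\cup\{yz: xz\in E(G), z\in V(H)\}$. $e(\cdot)$ denotes the number of edges; cycle length is number of edges. -}

module Defs where

open import Data.Nat using (ℕ; zero; suc; _+_; _<_; _≤_)
open import Data.Nat.Divisibility using (_∣_)
open import Data.Fin using (Fin; toℕ; fromℕ; inject₁; _≟_) renaming (zero to fzero; suc to fsuc)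
open import Data.Bool using (Bool; true; false; if_then_else_)
open import Data.List using (List; map; allFin)
open import Data.Nat.ListAction using (sum)
open import Data.Product using (Σ; ∃; _×_; _,_)
open import Relation.Nullary using (¬_; yes; no)
open import Relation.Nullary.Decidable using (⌊_⌋)
open import Relation.Binary.PropositionalEquality using (_≡_; _≢_)
open import Function.Definitions using (Injective)
open import Function.Bundles using (_⇔_)

Adj : ℕ → Set
Adj n = Fin n → Fin n → Bool

record SimpleGraph (n : ℕ) : Set where
  field
    adj    : Adj n
    sym    : ∀ u v → adj u v ≡ adj v u
    irrefl : ∀ v → adj v v ≡ false
open SimpleGraph public

edgeCount : ∀ {n} → Adj n → ℕ
edgeCount {n} A =
  sum (map (λ u → sum (map (λ v →
        if ⌊ toℕ u Data.Nat.<? toℕ v ⌋ then (if A u v then 1 else 0) else 0)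
      (allFin n))) (allFin n))

record CycleOfLength {n : ℕ} (A : Adj n) (len : ℕ) : Set where
  field
    m        : ℕ
    len≡     : len ≡ suc m
    m≥2      : 2 ≤ m
    vertex   : Fin (suc m) → Fin n
    distinct : Injective _≡_ _≡_ vertex
    step     : ∀ (i : Fin m) → A (vertex (inject₁ i)) (vertex (fsuc i)) ≡ true
    close    : A (vertex (fromℕ m)) (vertex fzero) ≡ true

HasCycle4 : ∀ {n} → Adj n → Set
HasCycle4 A = ∃ λ len → (4 ∣ len) × CycleOfLength A len

-- Reachability in G - {x,y}: a walk from u to w all of whose vertices after u
-- avoid x and y (u itself is required to avoid x,y separately where used).
data ReachAvoid {n : ℕ} (A : Adj n) (x y u : Fin n) : Fin n → Set where
  here : ReachAvoid A x y u u
  step : ∀ {v w} → ReachAvoid A x y u v → A v w ≡ true → w ≢ x → w ≢ y →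
         ReachAvoid A x y u w

IsVertexCut2 : ∀ {n} → SimpleGraph n → Fin n → Fin n → Set
IsVertexCut2 G x y =
  x ≢ y × ∃ λ u → ∃ λ v → u ≢ x × u ≢ y × v ≢ x × v ≢ y ×
    ¬ ReachAvoid (adj G) x y u v

IsComponent : ∀ {n} → SimpleGraph n → Fin n → Fin n → (Fin n → Bool) → Set
IsComponent G x y H =
  ∃ λ h → h ≢ x × h ≢ y ×
    (∀ z → (H z ≡ true) ⇔ (z ≢ x × z ≢ y × ReachAvoid (adj G) x y h z))

swapXY : ∀ {n} → Fin n → Fin n → Fin n → Fin n
swapXY x y u with u ≟ x
... | yes _ = y
... | no _ with u ≟ y
...   | yes _ = x
...   | no _ = u

-- Switching of G at {x,y} w.r.t. H: for z ∈ H, the neighbourhoods of x and y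
-- inside H are exchanged; all other adjacencies unchanged.
switching : ∀ {n} → SimpleGraph n → Fin n → Fin n → (Fin n → Bool) → Adj n
switching G x y H u v =
  adj G (if H v then swapXY x y u else u) (if H u then swapXY x y v else v)

-- Write σ for the transposition of x and y. The switching reads adjacency across the
-- boundary of H through σ, so the row of a vertex of H is permuted by σ, rows outside
-- H ∪ {x, y} are unchanged, and rows x and y are exchanged inside each column of H.
-- Hence the degree sum, twice the number of edges, is unchanged.
--
-- Switching twice gives back G, and H stays separated from the rest by {x, y}, so it
-- suffices to turn every cycle C of G into a cycle of G′ of the same length. If C avoids
-- H it is still a cycle of G′; if C lies in H ∪ {x, y}, its image under σ is one. Otherwise
-- C meets H in a single run of consecutive vertices, entered through one of x, y and left
-- through the other, and reversing that run yields a cycle of G′. The cut hypothesis is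
-- only needed for x ≠ y.

module Submission where

open import Defs renaming (sym to adj-sym)
open import Data.Bool.Properties using (¬-not)
open import Data.Bool using (Bool; true; false; if_then_else_) renaming (_≟_ to _≟ᵇ_)
open import Data.Fin using (Fin; toℕ; fromℕ; fromℕ<; inject₁; _≟_)
  renaming (zero to fzero; suc to fsuc)
open import Data.Fin.Permutation using (Permutation′; permutation; _⟨$⟩ʳ_)
open import Data.Fin.Properties
  using (toℕ-injective; toℕ-fromℕ; toℕ-fromℕ<; toℕ-inject₁; toℕ<n; toℕ≤pred[n])
open import Data.List using (map; allFin; tabulate)
open import Data.List.Properties using (map-tabulate)
open import Data.Nat using (ℕ; zero; suc; _+_; _*_; _∸_; _≤_; _<_; z≤n; s≤s; z<s; _<?_; _≤?_)
open import Data.Nat.ListAction using (sum)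
open import Data.Nat.Properties
  using ( +-0-commutativeMonoid; anyUpTo?; +-identityʳ; +-comm; +-suc; +-monoʳ-≤
        ; +-cancelʳ-≡; +-cancelʳ-≤; *-cancelˡ-≡; m∸n+n≡m; m≤n+m
        ; ≤-refl; ≤-trans; ≤-antisym; ≤-pred; <-irrefl; <-asym; <-trans; <-≤-trans; <-cmp
        ; <⇒≤; <⇒≱; ≮⇒≥; ≰⇒>; n<1+n; m≤n⇒m≤1+n; m<n⇒m<1+n; m<1+n⇒m≤n; m<1+n⇒m<n∨m≡n
        ; m≤n⇒m<n∨m≡n; suc-injective )
open import Algebra.Properties.CommutativeMonoid.Sum +-0-commutativeMonoid
  using (sum-cong-≗; ∑-distrib-+; ∑-comm; sum-permute) renaming (sum to ∑)
open import Data.Empty using (⊥-elim)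
open import Data.Unit using (⊤; tt)
open import Data.Product using (∃; _×_; _,_; proj₁; proj₂; uncurry)
open import Data.Sum using (_⊎_; inj₁; inj₂; [_,_]′)
open import Function using (_∘_; id; flip)
open import Function.Bundles using (_⇔_; mk⇔; Equivalence)
open import Function.Definitions using (Injective)
open import Relation.Binary.PropositionalEquality
open import Relation.Binary.Definitions using (tri<; tri≈; tri>)
open import Relation.Nullary using (¬_; Dec; yes; no)
open import Relation.Nullary.Decidable using (⌊_⌋; _⊎-dec_; _×-dec_; ¬?; decidable-stable)

open ≡-Reasoning

true≢false : true ≢ false
true≢false ()

true-or-false : ∀ b → b ≡ true ⊎ b ≡ false
true-or-false true  = inj₁ refl
true-or-false false = inj₂ refl

2*m≡m+m : ∀ m → 2 * m ≡ m + m
2*m≡m+m m = cong (m +_) (+-identityʳ m)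

∑-+-∘permute : ∀ {n} (π : Permutation′ n) (f : Fin n → ℕ) →
  ∑ (λ u → f u + f (π ⟨$⟩ʳ u)) ≡ 2 * ∑ f
∑-+-∘permute π f = begin
  ∑ (λ u → f u + f (π ⟨$⟩ʳ u))  ≡⟨ ∑-distrib-+ f (f ∘ (π ⟨$⟩ʳ_)) ⟩
  ∑ f + ∑ (f ∘ (π ⟨$⟩ʳ_))       ≡⟨ cong (∑ f +_) (sum-permute f π) ⟨
  ∑ f + ∑ f                     ≡⟨ 2*m≡m+m (∑ f) ⟨
  2 * ∑ f                       ∎

∑-cong-pairs : ∀ {n} (π : Permutation′ n) {f g : Fin n → ℕ} →
  (∀ u → f u + f (π ⟨$⟩ʳ u) ≡ g u + g (π ⟨$⟩ʳ u)) → ∑ f ≡ ∑ g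
∑-cong-pairs π {f} {g} eq = *-cancelˡ-≡ (∑ f) (∑ g) 2 (begin
  2 * ∑ f                       ≡⟨ ∑-+-∘permute π f ⟨
  ∑ (λ u → f u + f (π ⟨$⟩ʳ u))  ≡⟨ sum-cong-≗ eq ⟩
  ∑ (λ u → g u + g (π ⟨$⟩ʳ u))  ≡⟨ ∑-+-∘permute π g ⟩
  2 * ∑ g                       ∎)

sum-tabulate : ∀ {n} (g : Fin n → ℕ) → sum (tabulate g) ≡ ∑ g
sum-tabulate {zero}  g = refl
sum-tabulate {suc n} g = cong (g fzero +_) (sum-tabulate (g ∘ fsuc))

sum-map-allFin : ∀ {n} (g : Fin n → ℕ) → sum (map g (allFin n)) ≡ ∑ g
sum-map-allFin {n} g = trans (cong sum (map-tabulate id g)) (sum-tabulate g)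

indicator : Bool → ℕ
indicator b = if b then 1 else 0

degree : ∀ {n} → Adj n → Fin n → ℕ
degree A u = ∑ (λ v → indicator (A u v))

module _ {n : ℕ} (G : SimpleGraph n) where

  private
    upper : Fin n → Fin n → ℕ
    upper u v = if ⌊ toℕ u <? toℕ v ⌋ then indicator (adj G u v) else 0

    edgeCount-∑ : edgeCount (adj G) ≡ ∑ (λ u → ∑ (upper u))
    edgeCount-∑ = trans (sum-map-allFin (λ u → sum (map (upper u) (allFin n))))
                        (sum-cong-≗ (λ u → sum-map-allFin (upper u)))

    indicator-split : ∀ u v → indicator (adj G u v) ≡ upper u v + upper v u
    indicator-split u v with toℕ u <? toℕ v | toℕ v <? toℕ u
    ... | yes u<v | yes v<u = ⊥-elim (<-asym u<v v<u)
    ... | yes _   | no _    = sym (+-identityʳ _)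
    ... | no _    | yes _   = cong indicator (adj-sym G u v)
    ... | no u≮v  | no v≮u with toℕ-injective (≤-antisym (≮⇒≥ v≮u) (≮⇒≥ u≮v))
    ...   | refl rewrite irrefl G u = refl

  ∑-degree : ∑ (degree (adj G)) ≡ 2 * edgeCount (adj G)
  ∑-degree = begin
    ∑ (degree (adj G))
      ≡⟨ sum-cong-≗ (λ u → sum-cong-≗ (indicator-split u)) ⟩
    ∑ (λ u → ∑ (λ v → upper u v + upper v u))
      ≡⟨ sum-cong-≗ (λ u → ∑-distrib-+ (upper u) (λ v → upper v u)) ⟩
    ∑ (λ u → ∑ (upper u) + ∑ (λ v → upper v u))
      ≡⟨ ∑-distrib-+ (λ u → ∑ (upper u)) (λ u → ∑ (λ v → upper v u)) ⟩
    ∑ (λ u → ∑ (upper u)) + ∑ (λ u → ∑ (λ v → upper v u))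
      ≡⟨ cong (∑ (λ u → ∑ (upper u)) +_) (∑-comm (λ u v → upper v u)) ⟩
    ∑ (λ u → ∑ (upper u)) + ∑ (λ u → ∑ (upper u))
      ≡⟨ cong₂ _+_ edgeCount-∑ edgeCount-∑ ⟨
    edgeCount (adj G) + edgeCount (adj G)
      ≡⟨ 2*m≡m+m (edgeCount (adj G)) ⟨
    2 * edgeCount (adj G)
      ∎

module _ {n : ℕ} {x y : Fin n} where

  swapXY-x : swapXY x y x ≡ y
  swapXY-x with x ≟ x
  ... | yes _   = refl
  ... | no x≢x = ⊥-elim (x≢x refl)

  swapXY-y : x ≢ y → swapXY x y y ≡ x
  swapXY-y x≢y with y ≟ x
  ... | yes y≡x = ⊥-elim (x≢y (sym y≡x))
  ... | no _ with y ≟ y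
  ...   | yes _   = refl
  ...   | no y≢y = ⊥-elim (y≢y refl)

  swapXY-other : ∀ {u} → u ≢ x → u ≢ y → swapXY x y u ≡ u
  swapXY-other {u} u≢x u≢y with u ≟ x
  ... | yes u≡x = ⊥-elim (u≢x u≡x)
  ... | no _ with u ≟ y
  ...   | yes u≡y = ⊥-elim (u≢y u≡y)
  ...   | no _    = refl

  swapXY-involutive : x ≢ y → ∀ u → swapXY x y (swapXY x y u) ≡ u
  swapXY-involutive x≢y u with u ≟ x
  ... | yes refl = swapXY-y x≢y
  ... | no u≢x with u ≟ y
  ...   | yes refl = swapXY-x
  ...   | no u≢y   = swapXY-other u≢x u≢y

  swapXY-injective : x ≢ y → Injective _≡_ _≡_ (swapXY x y)
  swapXY-injective x≢y {u} {v} eq = begin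
    u                          ≡⟨ swapXY-involutive x≢y u ⟨
    swapXY x y (swapXY x y u)  ≡⟨ cong (swapXY x y) eq ⟩
    swapXY x y (swapXY x y v)  ≡⟨ swapXY-involutive x≢y v ⟩
    v                          ∎

  swapXY-permutation : x ≢ y → Permutation′ n
  swapXY-permutation x≢y =
    permutation (swapXY x y) (swapXY x y) (swapXY-involutive x≢y) (swapXY-involutive x≢y)

-- vertex 0, …, vertex m in cyclic order, so a cycle of length suc m; vertex is junk beyond m.
record Cycle {n : ℕ} (A : Adj n) (m : ℕ) : Set where
  field
    vertex    : ℕ → Fin n
    2≤m       : 2 ≤ m
    injective : ∀ {i j} → i ≤ m → j ≤ m → vertex i ≡ vertex j → i ≡ j
    edge      : ∀ {i} → i < m → A (vertex i) (vertex (suc i)) ≡ true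
    closing   : A (vertex m) (vertex 0) ≡ true

clamp : ∀ m → ℕ → Fin (suc m)
clamp m       zero    = fzero
clamp zero    (suc i) = fzero
clamp (suc m) (suc i) = fsuc (clamp m i)

toℕ-clamp : ∀ {m i} → i ≤ m → toℕ (clamp m i) ≡ i
toℕ-clamp {m}     {zero}  _         = refl
toℕ-clamp {suc m} {suc i} (s≤s i≤m) = cong suc (toℕ-clamp i≤m)

clamp-toℕ : ∀ m (k : Fin (suc m)) → clamp m (toℕ k) ≡ k
clamp-toℕ m       fzero    = refl
clamp-toℕ (suc m) (fsuc k) = cong fsuc (clamp-toℕ m k)

module _ {n : ℕ} {A : Adj n} where

  fromCycleOfLength : ∀ {len} → CycleOfLength A len → ∃ λ m → len ≡ suc m × Cycle A m
  fromCycleOfLength c = m , len≡ , record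
    { vertex    = vertex ∘ clamp m
    ; 2≤m       = m≥2
    ; injective = λ {i} {j} i≤m j≤m eq → begin
        i                   ≡⟨ toℕ-clamp i≤m ⟨
        toℕ (clamp m i)     ≡⟨ cong toℕ (distinct eq) ⟩
        toℕ (clamp m j)     ≡⟨ toℕ-clamp j≤m ⟩
        j                   ∎
    ; edge      = edge
    ; closing   = subst (λ k → A (vertex k) (vertex fzero) ≡ true) clamp-m close
    }
    where
    open CycleOfLength c

    clamp-m : fromℕ m ≡ clamp m m
    clamp-m = trans (sym (clamp-toℕ m (fromℕ m))) (cong (clamp m) (toℕ-fromℕ m))

    edge : ∀ {i} → i < m → A (vertex (clamp m i)) (vertex (clamp m (suc i))) ≡ true
    edge {i} i<m =
      subst₂ (λ k l → A (vertex k) (vertex l) ≡ true) inject≡ suc≡ (CycleOfLength.step c k)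
      where
      k : Fin m
      k = fromℕ< i<m
      inject≡ : inject₁ k ≡ clamp m i
      inject≡ = toℕ-injective (begin
        toℕ (inject₁ k)  ≡⟨ toℕ-inject₁ k ⟩
        toℕ k            ≡⟨ toℕ-fromℕ< i<m ⟩
        i                ≡⟨ toℕ-clamp (<⇒≤ i<m) ⟨
        toℕ (clamp m i)  ∎)
      suc≡ : fsuc k ≡ clamp m (suc i)
      suc≡ = toℕ-injective (trans (cong suc (toℕ-fromℕ< i<m)) (sym (toℕ-clamp i<m)))

  toCycleOfLength : ∀ {m} → Cycle A m → CycleOfLength A (suc m)
  toCycleOfLength {m} c = record
    { m        = m
    ; len≡     = refl
    ; m≥2      = 2≤m
    ; vertex   = vertex ∘ toℕ
    ; distinct = λ {k} {l} eq → toℕ-injective (injective (toℕ≤pred[n] k) (toℕ≤pred[n] l) eq)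
    ; step     = λ k → subst (λ i → A (vertex i) (vertex (suc (toℕ k))) ≡ true)
                             (sym (toℕ-inject₁ k)) (edge (toℕ<n k))
    ; close    = subst (λ i → A (vertex i) (vertex 0) ≡ true) (sym (toℕ-fromℕ m)) closing
    }
    where open Cycle c

hasCycle4-map : ∀ {n} {A B : Adj n} → (∀ {m} → Cycle A m → Cycle B m) → HasCycle4 A → HasCycle4 B
hasCycle4-map F (len , 4∣len , c) with fromCycleOfLength c
... | m , refl , c′ = suc m , 4∣len , toCycleOfLength (F c′)

module _ {n : ℕ} {A : Adj n} {m : ℕ} (c : Cycle A m) where
  open Cycle c

  mapCycle : ∀ {B : Adj n} (P : Fin n → Set) (φ : Fin n → Fin n) → Injective _≡_ _≡_ φ →
    (∀ {i} → i ≤ m → P (vertex i)) →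
    (∀ {u v} → P u → P v → A u v ≡ true → B (φ u) (φ v) ≡ true) → Cycle B m
  mapCycle P φ φ-injective P-vertex map-edge = record
    { vertex    = φ ∘ vertex
    ; 2≤m       = 2≤m
    ; injective = λ i≤m j≤m eq → injective i≤m j≤m (φ-injective eq)
    ; edge      = λ i<m → map-edge (P-vertex (<⇒≤ i<m)) (P-vertex i<m) (edge i<m)
    ; closing   = map-edge (P-vertex ≤-refl) (P-vertex z≤n) closing
    }

  private
    next : ℕ → ℕ
    next i with i <? m
    ... | yes _ = suc i
    ... | no _  = 0

    next-< : ∀ {i} → i < m → next i ≡ suc i
    next-< {i} i<m with i <? m
    ... | yes _   = refl
    ... | no i≮m = ⊥-elim (i≮m i<m)

    next-m : next m ≡ 0
    next-m with m <? m
    ... | yes m<m = ⊥-elim (<-irrefl refl m<m)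
    ... | no _    = refl

    next-cases : ∀ {i} → i ≤ m → (i < m × next i ≡ suc i) ⊎ (i ≡ m × next i ≡ 0)
    next-cases {i} i≤m with i <? m
    ... | yes i<m = inj₁ (i<m , refl)
    ... | no i≮m  = inj₂ (≤-antisym i≤m (≮⇒≥ i≮m) , refl)

    next-injective : ∀ {i j} → i ≤ m → j ≤ m → vertex (next i) ≡ vertex (next j) → i ≡ j
    next-injective i≤m j≤m eq with next-cases i≤m | next-cases j≤m
    ... | inj₁ (i<m , i↦) | inj₁ (j<m , j↦) rewrite i↦ | j↦ = suc-injective (injective i<m j<m eq)
    ... | inj₁ (i<m , i↦) | inj₂ (_ , j↦)   rewrite i↦ | j↦ with () ← injective i<m z≤n eq
    next-injective i≤m j≤m eq | inj₂ (_ , i↦) | inj₁ (j<m , j↦) rewrite i↦ | j↦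
      with () ← injective z≤n j<m eq
    next-injective i≤m j≤m eq | inj₂ (i≡m , _) | inj₂ (j≡m , _) = trans i≡m (sym j≡m)

    next-edge : ∀ {i} → i < m → A (vertex (next i)) (vertex (next (suc i))) ≡ true
    next-edge {i} i<m rewrite next-< i<m with next-cases i<m
    ... | inj₁ (i+1<m , eq) rewrite eq = edge i+1<m
    ... | inj₂ (refl , eq)  rewrite eq = closing

    0<m : 0 < m
    0<m = <-≤-trans z<s 2≤m

  rotateOnce : Cycle A m
  rotateOnce = record
    { vertex    = vertex ∘ next
    ; 2≤m       = 2≤m
    ; injective = next-injective
    ; edge      = next-edge
    ; closing   = subst₂ (λ i j → A (vertex i) (vertex j) ≡ true)
                    (sym next-m) (sym (next-< 0<m)) (edge 0<m)
    }

  rotateOnce-vertex : ∀ {i} → i < m → Cycle.vertex rotateOnce i ≡ vertex (suc i)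
  rotateOnce-vertex i<m = cong vertex (next-< i<m)

rotate : ∀ {n} {A : Adj n} {m} → ℕ → Cycle A m → Cycle A m
rotate zero    c = c
rotate (suc r) c = rotate r (rotateOnce c)

rotate-vertex₀ : ∀ {n} {A : Adj n} {m} r (c : Cycle A m) → r ≤ m →
  Cycle.vertex (rotate r c) 0 ≡ Cycle.vertex c r
rotate-vertex₀ zero    c _   = refl
rotate-vertex₀ (suc r) c r<m =
  trans (rotate-vertex₀ r (rotateOnce c) (<⇒≤ r<m)) (rotateOnce-vertex c r<m)

module _ {p} {P : ℕ → Set p} (P? : ∀ t → Dec (P t)) where

  private
    leastBelow : ∀ v → (∃ λ k → k < v × P k × (∀ {s} → s < k → ¬ P s)) ⊎ (∀ {s} → s < v → ¬ P s)
    leastBelow zero = inj₂ λ ()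
    leastBelow (suc v) with leastBelow v
    ... | inj₁ (k , k<v , Pk , below) = inj₁ (k , m<n⇒m<1+n k<v , Pk , below)
    ... | inj₂ none with P? v
    ...   | yes Pv = inj₁ (v , ≤-refl , Pv , none)
    ...   | no ¬Pv = inj₂ λ s<1+v → [ none , (λ { refl → ¬Pv }) ]′ (m<1+n⇒m<n∨m≡n s<1+v)

  leastWitness : ∀ {b} → P b → ∃ λ k → k ≤ b × P k × (∀ {s} → s < k → ¬ P s)
  leastWitness {b} Pb with leastBelow (suc b)
  ... | inj₁ (k , k<1+b , Pk , below) = k , m<1+n⇒m≤n k<1+b , Pk , below
  ... | inj₂ none = ⊥-elim (none ≤-refl Pb)

module Reflection (a b : ℕ) where

  reflect : ℕ → ℕ
  reflect t with a ≤? t | t ≤? b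
  ... | yes _ | yes _ = a + b ∸ t
  ... | _     | _     = t

  reflect-outside : ∀ {t} → t < a ⊎ b < t → reflect t ≡ t
  reflect-outside {t} outside with a ≤? t | t ≤? b
  ... | no _    | _       = refl
  ... | yes _   | no _    = refl
  ... | yes a≤t | yes t≤b = ⊥-elim ([ flip <⇒≱ a≤t , flip <⇒≱ t≤b ]′ outside)

  reflect-+ : ∀ {t} → a ≤ t → t ≤ b → reflect t + t ≡ a + b
  reflect-+ {t} a≤t t≤b with a ≤? t | t ≤? b
  ... | yes _   | yes _   = m∸n+n≡m (≤-trans t≤b (m≤n+m b a))
  ... | no a≰t  | _       = ⊥-elim (a≰t a≤t)
  ... | yes _   | no t≰b  = ⊥-elim (t≰b t≤b)

  reflect-inside : ∀ {t} → a ≤ t → t ≤ b → a ≤ reflect t × reflect t ≤ b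
  reflect-inside {t} a≤t t≤b =
      +-cancelʳ-≤ t a (reflect t) (subst (a + t ≤_) (sym (reflect-+ a≤t t≤b)) (+-monoʳ-≤ a t≤b))
    , +-cancelʳ-≤ t (reflect t) b (subst (_≤ b + t) (sym sum≡) (+-monoʳ-≤ b a≤t))
    where
    sum≡ : reflect t + t ≡ b + a
    sum≡ = trans (reflect-+ a≤t t≤b) (+-comm a b)

  position : ∀ t → (a ≤ t × t ≤ b) ⊎ (t < a ⊎ b < t)
  position t with a ≤? t | t ≤? b
  ... | yes a≤t | yes t≤b = inj₁ (a≤t , t≤b)
  ... | no a≰t  | _       = inj₂ (inj₁ (≰⇒> a≰t))
  ... | yes _   | no t≰b  = inj₂ (inj₂ (≰⇒> t≰b))

  reflect-involutive : ∀ t → reflect (reflect t) ≡ t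
  reflect-involutive t with position t
  ... | inj₂ outside = trans (cong reflect (reflect-outside outside)) (reflect-outside outside)
  ... | inj₁ (a≤t , t≤b) = +-cancelʳ-≡ (reflect t) (reflect (reflect t)) t (begin
    reflect (reflect t) + reflect t  ≡⟨ uncurry reflect-+ (reflect-inside a≤t t≤b) ⟩
    a + b                            ≡⟨ reflect-+ a≤t t≤b ⟨
    reflect t + t                    ≡⟨ +-comm (reflect t) t ⟩
    t + reflect t                    ∎)

  reflect-first : a ≤ b → reflect a ≡ b
  reflect-first a≤b = +-cancelʳ-≡ a (reflect a) b (trans (reflect-+ ≤-refl a≤b) (+-comm a b))

  reflect-last : a ≤ b → reflect b ≡ a
  reflect-last a≤b = +-cancelʳ-≡ b (reflect b) a (reflect-+ a≤b ≤-refl)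

  reflect-suc : ∀ {t} → a ≤ t → t < b → reflect t ≡ suc (reflect (suc t))
  reflect-suc {t} a≤t t<b = +-cancelʳ-≡ t (reflect t) (suc (reflect (suc t))) (begin
    reflect t + t                ≡⟨ reflect-+ a≤t (<⇒≤ t<b) ⟩
    a + b                        ≡⟨ reflect-+ (m≤n⇒m≤1+n a≤t) t<b ⟨
    reflect (suc t) + suc t      ≡⟨ +-suc (reflect (suc t)) t ⟩
    suc (reflect (suc t)) + t    ∎)

  reflect-≤ : ∀ {m t} → b ≤ m → t ≤ m → reflect t ≤ m
  reflect-≤ {m} {t} b≤m t≤m with position t
  ... | inj₁ (a≤t , t≤b) = ≤-trans (proj₂ (reflect-inside a≤t t≤b)) b≤m
  ... | inj₂ outside     = subst (_≤ m) (sym (reflect-outside outside)) t≤m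

module _ {n : ℕ} {A : Adj n} {m : ℕ} (c : Cycle A m) where
  open Cycle c

  reverseSegment : ∀ {B : Adj n} {j b} → j < b → b < m →
    (∀ {t} → t < m → t < j ⊎ b < t → B (vertex t) (vertex (suc t)) ≡ true) →
    B (vertex j) (vertex b) ≡ true →
    (∀ {s} → j < s → s < b → B (vertex (suc s)) (vertex s) ≡ true) →
    B (vertex (suc j)) (vertex (suc b)) ≡ true →
    B (vertex m) (vertex 0) ≡ true →
    Cycle B m
  reverseSegment {B} {j} {b} j<b b<m outside enter inside leave closing′ = record
    { vertex    = vertex ∘ reflect
    ; 2≤m       = 2≤m
    ; injective = λ {t} {u} t≤m u≤m eq → begin
        t                    ≡⟨ reflect-involutive t ⟨
        reflect (reflect t)  ≡⟨ cong reflect (injective (reflect-≤ b≤m t≤m) (reflect-≤ b≤m u≤m) eq) ⟩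
        reflect (reflect u)  ≡⟨ reflect-involutive u ⟩
        u                    ∎
    ; edge      = edge′
    ; closing   = subst₂ (λ t u → B (vertex t) (vertex u) ≡ true)
                    (sym (reflect-outside (inj₂ b<m))) (sym (reflect-outside (inj₁ z<s))) closing′
    }
    where
    open Reflection (suc j) b
    b≤m : b ≤ m
    b≤m = <⇒≤ b<m

    edge′ : ∀ {t} → t < m → B (vertex (reflect t)) (vertex (reflect (suc t))) ≡ true
    edge′ {t} t<m with <-cmp t j
    ... | tri< t<j _ _
      rewrite reflect-outside (inj₁ (m<n⇒m<1+n t<j)) | reflect-outside (inj₁ (s≤s t<j)) =
        outside t<m (inj₁ t<j)
    ... | tri≈ _ refl _ rewrite reflect-outside (inj₁ (n<1+n j)) | reflect-first j<b = enter
    ... | tri> _ _ j<t with <-cmp t b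
    ...   | tri< t<b _ _ =
        subst (λ r → B (vertex r) (vertex s) ≡ true) (sym (reflect-suc j<t t<b)) (inside j<s s<b)
      where
      s : ℕ
      s = reflect (suc t)
      j<s : j < s
      j<s = proj₁ (reflect-inside (m≤n⇒m≤1+n j<t) t<b)
      s<b : s < b
      s<b = subst (_≤ b) (reflect-suc j<t t<b) (proj₂ (reflect-inside j<t (<⇒≤ t<b)))
    ...   | tri≈ _ refl _ rewrite reflect-last j<b | reflect-outside (inj₂ (n<1+n b)) = leave
    ...   | tri> _ _ b<t
      rewrite reflect-outside (inj₂ b<t) | reflect-outside (inj₂ (m<n⇒m<1+n b<t)) =
        outside t<m (inj₂ b<t)

switchingGraph : ∀ {n} → SimpleGraph n → Fin n → Fin n → (Fin n → Bool) → SimpleGraph n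
switchingGraph G x y H = record
  { adj    = switching G x y H
  ; sym    = λ _ _ → adj-sym G _ _
  ; irrefl = λ _ → irrefl G _
  }

switching-at : ∀ {n} (G : SimpleGraph n) x y H {u v b c} → H u ≡ b → H v ≡ c →
  switching G x y H u v ≡ adj G (if c then swapXY x y u else u) (if b then swapXY x y v else v)
switching-at G x y H Hu Hv rewrite Hu | Hv = refl

module _ {n : ℕ} (x y : Fin n) where

  OnCut : Fin n → Set
  OnCut u = u ≡ x ⊎ u ≡ y

  onCut? : ∀ u → OnCut u ⊎ (u ≢ x × u ≢ y)
  onCut? u with u ≟ x | u ≟ y
  ... | yes u≡x | _       = inj₁ (inj₁ u≡x)
  ... | no _    | yes u≡y = inj₁ (inj₂ u≡y)
  ... | no u≢x  | no u≢y  = inj₂ (u≢x , u≢y)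

  InsideOf : (Fin n → Bool) → Fin n → Set
  InsideOf H u = H u ≡ true ⊎ OnCut u

  InsideOf? : ∀ H u → Dec (InsideOf H u)
  InsideOf? H u = (H u ≟ᵇ true) ⊎-dec (u ≟ x) ⊎-dec (u ≟ y)

  OnCut-other : ∀ {p q r} → OnCut p → OnCut q → p ≢ q → OnCut r → r ≡ p ⊎ r ≡ q
  OnCut-other (inj₁ refl) (inj₁ refl) p≢q _           = ⊥-elim (p≢q refl)
  OnCut-other (inj₂ refl) (inj₂ refl) p≢q _           = ⊥-elim (p≢q refl)
  OnCut-other (inj₁ refl) (inj₂ refl) _   (inj₁ refl) = inj₁ refl
  OnCut-other (inj₁ refl) (inj₂ refl) _   (inj₂ refl) = inj₂ refl
  OnCut-other (inj₂ refl) (inj₁ refl) _   (inj₁ refl) = inj₂ refl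
  OnCut-other (inj₂ refl) (inj₁ refl) _   (inj₂ refl) = inj₁ refl

  swapXY-OnCut : x ≢ y → ∀ {p q} → OnCut p → OnCut q → p ≢ q → swapXY x y p ≡ q
  swapXY-OnCut _   (inj₁ refl) (inj₁ refl) p≢q = ⊥-elim (p≢q refl)
  swapXY-OnCut _   (inj₂ refl) (inj₂ refl) p≢q = ⊥-elim (p≢q refl)
  swapXY-OnCut _   (inj₁ refl) (inj₂ refl) _   = swapXY-x {x = x} {y = y}
  swapXY-OnCut x≢y (inj₂ refl) (inj₁ refl) _   = swapXY-y x≢y

Separated : ∀ {n} → SimpleGraph n → Fin n → Fin n → (Fin n → Bool) → Set
Separated G x y H = ∀ {u v} → H u ≡ true → adj G u v ≡ true → InsideOf x y H v

module Switching {n : ℕ} (G : SimpleGraph n) {x y : Fin n} (x≢y : x ≢ y)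
  (H : Fin n → Bool) (x∉H : H x ≡ false) (y∉H : H y ≡ false) where

  private
    A S : Adj n
    A = adj G
    S = switching G x y H

    σ : Fin n → Fin n
    σ = swapXY x y

    Inside : Fin n → Set
    Inside = InsideOf x y H

    Inside? : ∀ u → Dec (Inside u)
    Inside? = InsideOf? x y H

    σ-x : σ x ≡ y
    σ-x = swapXY-x {x = x} {y = y}

    σ-y : σ y ≡ x
    σ-y = swapXY-y x≢y

  ∉H-OnCut : ∀ {u} → OnCut x y u → H u ≡ false
  ∉H-OnCut (inj₁ refl) = x∉H
  ∉H-OnCut (inj₂ refl) = y∉H

  H-swapXY : ∀ u → H (σ u) ≡ H u
  H-swapXY u with onCut? x y u
  ... | inj₁ (inj₁ refl)   = trans (cong H σ-x) (trans y∉H (sym x∉H))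
  ... | inj₁ (inj₂ refl)   = trans (cong H σ-y) (trans x∉H (sym y∉H))
  ... | inj₂ (u≢x , u≢y)   = cong H (swapXY-other u≢x u≢y)

  swapXY-fixes-H : ∀ {u} → H u ≡ true → σ u ≡ u
  swapXY-fixes-H Hu = swapXY-other (λ { refl → true≢false (trans (sym Hu) x∉H) })
                                   (λ { refl → true≢false (trans (sym Hu) y∉H) })

  switching-outside : ∀ {u v} → H u ≡ false → H v ≡ false → S u v ≡ A u v
  switching-outside = switching-at G x y H

  switching-leaving : ∀ {u v} → H u ≡ true → H v ≡ false → S u v ≡ A u (σ v)
  switching-leaving = switching-at G x y H

  switching-entering : ∀ {u v} → H u ≡ false → H v ≡ true → S u v ≡ A (σ u) v
  switching-entering = switching-at G x y H

  switching-inside : ∀ {u v} → H u ≡ true → H v ≡ true → S u v ≡ A u v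
  switching-inside Hu Hv =
    trans (switching-at G x y H Hu Hv) (cong₂ A (swapXY-fixes-H Hu) (swapXY-fixes-H Hv))

  private
    swapIf : Bool → Fin n → Fin n
    swapIf b u = if b then σ u else u

    H-swapIf : ∀ b u → H (swapIf b u) ≡ H u
    H-swapIf true  u = H-swapXY u
    H-swapIf false u = refl

    swapIf-involutive : ∀ b u → swapIf b (swapIf b u) ≡ u
    swapIf-involutive true  u = swapXY-involutive x≢y u
    swapIf-involutive false u = refl

  switching-involutive : ∀ u v → switching (switchingGraph G x y H) x y H u v ≡ A u v
  switching-involutive u v = begin
    switching (switchingGraph G x y H) x y H u v
      ≡⟨⟩
    S (swapIf (H v) u) (swapIf (H u) v)
      ≡⟨ switching-at G x y H (H-swapIf (H v) u) (H-swapIf (H u) v) ⟩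
    A (swapIf (H v) (swapIf (H v) u)) (swapIf (H u) (swapIf (H u) v))
      ≡⟨ cong₂ A (swapIf-involutive (H v) u) (swapIf-involutive (H u) v) ⟩
    A u v
      ∎

  switching-row-H : ∀ {u} → H u ≡ true → ∀ v → S u v ≡ A u (σ v)
  switching-row-H Hu v with true-or-false (H v)
  ... | inj₁ Hv = trans (switching-inside Hu Hv) (cong (A _) (sym (swapXY-fixes-H Hv)))
  ... | inj₂ Hv = switching-leaving Hu Hv

  switching-row-off-cut : ∀ {u} → H u ≡ false → u ≢ x → u ≢ y → ∀ v → S u v ≡ A u v
  switching-row-off-cut Hu u≢x u≢y v with true-or-false (H v)
  ... | inj₁ Hv = trans (switching-entering Hu Hv) (cong (λ w → A w v) (swapXY-other u≢x u≢y))
  ... | inj₂ Hv = switching-outside Hu Hv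

  switching-cut-column : ∀ v →
    indicator (S x v) + indicator (S y v) ≡ indicator (A x v) + indicator (A y v)
  switching-cut-column v with true-or-false (H v)
  ... | inj₁ Hv rewrite switching-entering x∉H Hv | switching-entering y∉H Hv
                    | σ-x | σ-y =
    +-comm (indicator (A y v)) (indicator (A x v))
  ... | inj₂ Hv rewrite switching-outside x∉H Hv | switching-outside y∉H Hv = refl

  degree-off-cut : ∀ {u} → u ≢ x → u ≢ y → degree S u ≡ degree A u
  degree-off-cut {u} u≢x u≢y with true-or-false (H u)
  ... | inj₁ Hu = begin
    degree S u                       ≡⟨ sum-cong-≗ (cong indicator ∘ switching-row-H Hu) ⟩
    ∑ (λ v → indicator (A u (σ v)))  ≡⟨ sum-permute (λ v → indicator (A u v)) (swapXY-permutation x≢y) ⟨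
    degree A u                       ∎
  ... | inj₂ Hu = sum-cong-≗ (cong indicator ∘ switching-row-off-cut Hu u≢x u≢y)

  degree-cut : degree S x + degree S y ≡ degree A x + degree A y
  degree-cut = begin
    degree S x + degree S y                                ≡⟨ ∑-distrib-+ (λ v → indicator (S x v)) _ ⟨
    ∑ (λ v → indicator (S x v) + indicator (S y v))        ≡⟨ sum-cong-≗ switching-cut-column ⟩
    ∑ (λ v → indicator (A x v) + indicator (A y v))        ≡⟨ ∑-distrib-+ (λ v → indicator (A x v)) _ ⟩
    degree A x + degree A y                                ∎

  private
    along : ∀ {u w} → σ u ≡ w → degree S u + degree S w ≡ degree A u + degree A w →
      degree S u + degree S (σ u) ≡ degree A u + degree A (σ u)
    along refl eq = eq

  degree-pair : ∀ u → degree S u + degree S (σ u) ≡ degree A u + degree A (σ u)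
  degree-pair u with onCut? x y u
  ... | inj₁ (inj₁ refl) = along σ-x degree-cut
  ... | inj₁ (inj₂ refl) = along σ-y
    (trans (+-comm (degree S y) (degree S x)) (trans degree-cut (+-comm (degree A x) (degree A y))))
  ... | inj₂ (u≢x , u≢y) = along (swapXY-other u≢x u≢y)
    (cong₂ _+_ (degree-off-cut u≢x u≢y) (degree-off-cut u≢x u≢y))

  edgeCount-switching : edgeCount S ≡ edgeCount A
  edgeCount-switching = *-cancelˡ-≡ (edgeCount S) (edgeCount A) 2 (begin
    2 * edgeCount S  ≡⟨ ∑-degree (switchingGraph G x y H) ⟨
    ∑ (degree S)     ≡⟨ ∑-cong-pairs (swapXY-permutation x≢y) degree-pair ⟩
    ∑ (degree A)     ≡⟨ ∑-degree G ⟩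
    2 * edgeCount A  ∎)

  ∉H-swapXY-OnCut : ∀ {u} → OnCut x y u → H (σ u) ≡ false
  ∉H-swapXY-OnCut {u} cut = trans (H-swapXY u) (∉H-OnCut cut)

  Inside-swapXY : ∀ {u} → Inside (σ u) → Inside u
  Inside-swapXY {u} (inj₁ Hσu)         = inj₁ (trans (sym (H-swapXY u)) Hσu)
  Inside-swapXY {u} (inj₂ (inj₁ σu≡x)) = inj₂ (inj₂ (swapXY-injective x≢y (trans σu≡x (sym σ-y))))
  Inside-swapXY {u} (inj₂ (inj₂ σu≡y)) = inj₂ (inj₁ (swapXY-injective x≢y (trans σu≡y (sym σ-x))))

  adj-swapXY-OnCut : ∀ {u v} → OnCut x y u → OnCut x y v → A (σ u) (σ v) ≡ A u v
  adj-swapXY-OnCut {u} {v} cu cv with OnCut-other x y (inj₁ refl) (inj₂ refl) x≢y cu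
                                   | OnCut-other x y (inj₁ refl) (inj₂ refl) x≢y cv
  ... | inj₁ refl | inj₁ refl = trans (cong₂ A σ-x σ-x) (trans (irrefl G y) (sym (irrefl G x)))
  ... | inj₁ refl | inj₂ refl = trans (cong₂ A σ-x σ-y) (adj-sym G y x)
  ... | inj₂ refl | inj₁ refl = trans (cong₂ A σ-y σ-x) (adj-sym G x y)
  ... | inj₂ refl | inj₂ refl =
    trans (cong₂ A σ-y σ-y) (trans (irrefl G x) (sym (irrefl G y)))

  switching-swapXY : ∀ {u v} → Inside u → Inside v → S (σ u) (σ v) ≡ A u v
  switching-swapXY {u} {v} (inj₁ Hu) (inj₁ Hv) =
    trans (cong₂ S (swapXY-fixes-H Hu) (swapXY-fixes-H Hv)) (switching-inside Hu Hv)
  switching-swapXY {u} {v} (inj₁ Hu) (inj₂ cv) = begin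
    S (σ u) (σ v)    ≡⟨ cong (λ w → S w (σ v)) (swapXY-fixes-H Hu) ⟩
    S u (σ v)        ≡⟨ switching-leaving Hu (∉H-swapXY-OnCut cv) ⟩
    A u (σ (σ v))    ≡⟨ cong (A u) (swapXY-involutive x≢y v) ⟩
    A u v            ∎
  switching-swapXY {u} {v} (inj₂ cu) (inj₁ Hv) = begin
    S (σ u) (σ v)    ≡⟨ cong (S (σ u)) (swapXY-fixes-H Hv) ⟩
    S (σ u) v        ≡⟨ switching-entering (∉H-swapXY-OnCut cu) Hv ⟩
    A (σ (σ u)) v    ≡⟨ cong (λ w → A w v) (swapXY-involutive x≢y u) ⟩
    A u v            ∎
  switching-swapXY (inj₂ cu) (inj₂ cv) =
    trans (switching-outside (∉H-swapXY-OnCut cu) (∉H-swapXY-OnCut cv)) (adj-swapXY-OnCut cu cv)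

  separated-switching : Separated G x y H → Separated (switchingGraph G x y H) x y H
  separated-switching separated {u} {v} Hu uv with true-or-false (H v)
  ... | inj₁ Hv = inj₁ Hv
  ... | inj₂ Hv = Inside-swapXY (separated Hu (trans (sym (switching-leaving Hu Hv)) uv))

  module _ (separated : Separated G x y H) where

    private
      leaves-at-cut : ∀ {u v} → H u ≡ true → A u v ≡ true → H v ≡ false → OnCut x y v
      leaves-at-cut Hu uv Hv with separated Hu uv
      ... | inj₁ Hv′ = ⊥-elim (true≢false (trans (sym Hv′) Hv))
      ... | inj₂ cut = cut

      flipped : ∀ {u v} → A u v ≡ true → A v u ≡ true
      flipped {u} {v} uv = trans (adj-sym G v u) uv

    module _ {m : ℕ} (c : Cycle A m) where
      open Cycle c

      cut-after : ∀ {t} → t ≤ m → H (vertex t) ≡ true → H (vertex m) ≡ false →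
        ∃ λ k → t < k × k ≤ m × OnCut x y (vertex k)
      cut-after {t} t≤m Ht ∉H-last
        with leastWitness (λ s → (t ≤? s) ×-dec (H (vertex s) ≟ᵇ false)) (t≤m , ∉H-last)
      ... | k , k≤m , (t≤k , Hk) , earlier with m≤n⇒m<n∨m≡n t≤k
      ...   | inj₂ refl = ⊥-elim (true≢false (trans (sym Ht) Hk))
      ...   | inj₁ (s≤s {n = k′} t≤k′) =
        k , s≤s t≤k′ , k≤m
          , leaves-at-cut (¬-not λ Hk′ → earlier ≤-refl (t≤k′ , Hk′)) (edge k≤m) Hk

      module Run {j b} (j<b : j < b) (b<m : b < m)
        (before : ∀ {t} → t ≤ j → H (vertex t) ≡ false)
        (within : ∀ {t} → j < t → t ≤ b → H (vertex t) ≡ true)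
        (∉H-next : H (vertex (suc b)) ≡ false)
        (∉H-last : H (vertex m) ≡ false) where

        private
          cut-first : OnCut x y (vertex j)
          cut-first =
            leaves-at-cut (within (n<1+n j) j<b) (flipped (edge (<-trans j<b b<m))) (before ≤-refl)

          cut-next : OnCut x y (vertex (suc b))
          cut-next = leaves-at-cut (within j<b ≤-refl) (edge b<m) ∉H-next

          first≢next : vertex j ≢ vertex (suc b)
          first≢next eq = <-irrefl (injective (<⇒≤ (<-trans j<b b<m)) b<m eq) (m<n⇒m<1+n j<b)

          cut-index : ∀ {t} → t ≤ m → OnCut x y (vertex t) → t ≡ j ⊎ t ≡ suc b
          cut-index t≤m cut with OnCut-other x y cut-first cut-next first≢next cut
          ... | inj₁ eq = inj₁ (injective t≤m (<⇒≤ (<-trans j<b b<m)) eq)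
          ... | inj₂ eq = inj₂ (injective t≤m b<m eq)

          after : ∀ {t} → b < t → t ≤ m → H (vertex t) ≡ false
          after {t} b<t t≤m with true-or-false (H (vertex t))
          ... | inj₂ Ht = Ht
          ... | inj₁ Ht with cut-after t≤m Ht ∉H-last
          ...   | k , t<k , k≤m , cut with cut-index k≤m cut
          ...     | inj₁ refl = ⊥-elim (<-asym (<-trans j<b b<t) t<k)
          ...     | inj₂ refl = ⊥-elim (<⇒≱ b<t (≤-pred t<k))

          first↦next : σ (vertex j) ≡ vertex (suc b)
          first↦next = swapXY-OnCut x y x≢y cut-first cut-next first≢next

          next↦first : σ (vertex (suc b)) ≡ vertex j
          next↦first = swapXY-OnCut x y x≢y cut-next cut-first (first≢next ∘ sym)

        reversed : Cycle S m
        reversed = reverseSegment c j<b b<m outside enter inside leave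
          (trans (switching-outside ∉H-last (before z≤n)) closing)
          where
          outside : ∀ {t} → t < m → t < j ⊎ b < t → S (vertex t) (vertex (suc t)) ≡ true
          outside t<m (inj₁ t<j) =
            trans (switching-outside (before (<⇒≤ t<j)) (before t<j)) (edge t<m)
          outside t<m (inj₂ b<t) =
            trans (switching-outside (after b<t (<⇒≤ t<m)) (after (m<n⇒m<1+n b<t) t<m)) (edge t<m)

          enter : S (vertex j) (vertex b) ≡ true
          enter = begin
            S (vertex j) (vertex b)        ≡⟨ switching-entering (before ≤-refl) (within j<b ≤-refl) ⟩
            A (σ (vertex j)) (vertex b)    ≡⟨ cong (λ w → A w (vertex b)) first↦next ⟩
            A (vertex (suc b)) (vertex b)  ≡⟨ flipped (edge b<m) ⟩
            true                           ∎

          inside : ∀ {s} → j < s → s < b → S (vertex (suc s)) (vertex s) ≡ true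
          inside j<s s<b =
            trans (switching-inside (within (m<n⇒m<1+n j<s) s<b) (within j<s (<⇒≤ s<b)))
                  (flipped (edge (<-trans s<b b<m)))

          leave : S (vertex (suc j)) (vertex (suc b)) ≡ true
          leave = begin
            S (vertex (suc j)) (vertex (suc b))    ≡⟨ switching-leaving (within (n<1+n j) j<b) ∉H-next ⟩
            A (vertex (suc j)) (σ (vertex (suc b))) ≡⟨ cong (A (vertex (suc j))) next↦first ⟩
            A (vertex (suc j)) (vertex j)          ≡⟨ flipped (edge (<-trans j<b b<m)) ⟩
            true                                   ∎

      ∉H-last : ¬ Inside (vertex 0) → H (vertex m) ≡ false
      ∉H-last outside₀ with true-or-false (H (vertex m))
      ... | inj₁ Hm = ⊥-elim (outside₀ (separated Hm closing))
      ... | inj₂ Hm = Hm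

      cycle-through-outside : ¬ Inside (vertex 0) → Cycle S m
      cycle-through-outside outside₀ with anyUpTo? (λ t → H (vertex t) ≟ᵇ true) (suc m)
      ... | no noH = mapCycle c (λ u → H u ≡ false) id id
          (λ {i} i≤m → ¬-not λ Hi → noH (i , s≤s i≤m , Hi))
          (λ Hu Hv uv → trans (switching-outside Hu Hv) uv)
      ... | yes (i , s≤s i≤m , Hi)
        with leastWitness (λ t → H (vertex t) ≟ᵇ true) Hi
      ...   | zero , _ , H₀ , _ = ⊥-elim (outside₀ (inj₁ H₀))
      ...   | suc j , j<i , Hj+1 , outside-H
        with leastWitness (λ t → (suc j ≤? t) ×-dec (H (vertex t) ≟ᵇ false))
                          (≤-trans j<i i≤m , ∉H-last outside₀)
      ...     | k , k≤m , (j<k , Hk) , in-H with m≤n⇒m<n∨m≡n j<k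
      ...       | inj₂ refl = ⊥-elim (true≢false (trans (sym Hj+1) Hk))
      ...       | inj₁ (s≤s {n = b} j<b) =
        Run.reversed j<b k≤m
          (λ t≤j → ¬-not (outside-H (s≤s t≤j)))
          (λ j<t t≤b → ¬-not λ Ht → in-H (s≤s t≤b) (j<t , Ht))
          Hk (∉H-last outside₀)

    cycle-switching : ∀ {m} → Cycle A m → Cycle S m
    cycle-switching {m} c with anyUpTo? (λ t → ¬? (Inside? (Cycle.vertex c t))) (suc m)
    ... | yes (t , s≤s t≤m , outside) =
      cycle-through-outside (rotate t c) (subst (¬_ ∘ Inside) (sym (rotate-vertex₀ t c t≤m)) outside)
    ... | no none = mapCycle c Inside σ (swapXY-injective x≢y)
        (λ {t} t≤m → decidable-stable (Inside? _) λ outside → none (t , s≤s t≤m , outside))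
        (λ Iu Iv uv → trans (switching-swapXY Iu Iv) uv)

module _ {n : ℕ} (G : SimpleGraph n) {x y : Fin n} (x≢y : x ≢ y) (H : Fin n → Bool)
  (x∉H : H x ≡ false) (y∉H : H y ≡ false) (separated : Separated G x y H) where

  private
    module Once  = Switching G x≢y H x∉H y∉H
    module Twice = Switching (switchingGraph G x y H) x≢y H x∉H y∉H

  hasCycle4-switching : HasCycle4 (switching G x y H) ⇔ HasCycle4 (adj G)
  hasCycle4-switching = mk⇔ (hasCycle4-map unswitch) (hasCycle4-map (Once.cycle-switching separated))
    where
    unswitch : ∀ {m} → Cycle (switching G x y H) m → Cycle (adj G) m
    unswitch c = mapCycle (Twice.cycle-switching (Once.separated-switching separated) c)
      (λ _ → ⊤) id id (λ _ → tt) (λ _ _ uv → trans (sym (Once.switching-involutive _ _)) uv)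

module Component {n : ℕ} (G : SimpleGraph n) (x y : Fin n) (H : Fin n → Bool)
  (component : IsComponent G x y H) where

  private
    H⇒reachable : ∀ {z} → H z ≡ true → z ≢ x × z ≢ y × ReachAvoid (adj G) x y (proj₁ component) z
    H⇒reachable {z} = Equivalence.to (proj₂ (proj₂ (proj₂ component)) z)

    reachable⇒H : ∀ {z} → z ≢ x × z ≢ y × ReachAvoid (adj G) x y (proj₁ component) z → H z ≡ true
    reachable⇒H {z} = Equivalence.from (proj₂ (proj₂ (proj₂ component)) z)

  cut-∉H : ∀ {z} → OnCut x y z → H z ≡ false
  cut-∉H {z} cut with true-or-false (H z)
  ... | inj₂ Hz = Hz
  ... | inj₁ Hz with H⇒reachable Hz
  ...   | z≢x , z≢y , _ = ⊥-elim ([ z≢x , z≢y ]′ cut)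

  separated : Separated G x y H
  separated {u} {v} Hu uv with true-or-false (H v) | onCut? x y v
  ... | inj₁ Hv | _                = inj₁ Hv
  ... | inj₂ _  | inj₁ cut         = inj₂ cut
  ... | inj₂ Hv | inj₂ (v≢x , v≢y) with H⇒reachable Hu
  ...   | _ , _ , u-reachable =
    ⊥-elim (true≢false (trans (sym (reachable⇒H (v≢x , v≢y , step u-reachable uv v≢x v≢y))) Hv))

lemma10 : ∀ {n : ℕ} (G : SimpleGraph n) (x y : Fin n) (H : Fin n → Bool) →
    IsVertexCut2 G x y → IsComponent G x y H →
    (edgeCount (switching G x y H) ≡ edgeCount (adj G)) ×
    (HasCycle4 (switching G x y H) ⇔ HasCycle4 (adj G))
lemma10 G x y H (x≢y , _) component =
    Switching.edgeCount-switching G x≢y H x∉H y∉H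
  , hasCycle4-switching G x≢y H x∉H y∉H separated
  where
  open Component G x y H component

  x∉H : H x ≡ false
  x∉H = cut-∉H (inj₁ refl)

  y∉H : H y ≡ false
  y∉H = cut-∉H (inj₂ refl)
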